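{- Let $t,\Delta,\omega\ge 2$ be integers and write $\Delta=a(\omega-1)+b$ with integers $a\ge 0$ and $0\le b<\omega-1$. Then \[ f_t(\Delta,\omega)\ \le\ \frac1t\,k_{t-1}\big(T_{\omega-1}(\Delta)\big)=\frac1t\sum_{k=0}^{b}\binom{b}{k}\binom{\omega-1-b}{t-1-k}(a+1)^k a^{t-1-k}. \]
   Context: All graphs are finite and simple. For integers $\Delta,\omega$, let $\mathcal{G}(\Delta,\omega)$ be the class of graphs $G$ with maximum degree $\Delta(G)\le\Delta$ and clique number $\omega(G)\le\omega$. For a graph $G$, $k_t(G)$ denotes the number of copies of $K_t$ in $G$ (with $k_1(G)=|V(G)|$), and $\rho_t(G)=k_t(G)/|V(G)|$. For a positive integer $n$ let $k_t(n,\Delta,\omega)=\max\{k_t(G): |V(G)|=n,\ G\in\mathcal{G}(\Delta,\omega)\}$, and define $f_t(\Delta,\omega)=\lim_{n\to\infty}k_t(n,\Delta,\omega)/n$ (this limit exists and equals $\sup_{n}k_t(n,\Delta,\omega)/n$). $T_r(n)$ denotes the Turán graph: the complete $r$-partite graph on $n$ vertices whose part sizes differ by at most one. Binomial coefficients $\binom{m}{j}$ are $0$ when $j<0$ or $j>m$. -}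

module Defs where

open import Data.Nat using (ℕ; zero; suc; _+_; _*_; _∸_; _^_; _≤_; _<_; _≤ᵇ_; _%_)
open import Data.Nat.Combinatorics using (_C_)
open import Data.Bool using (Bool; true; false; _∧_; _∨_; not; if_then_else_)
open import Data.Fin using (Fin; toℕ; _≟_)
open import Data.Vec using (Vec; []; _∷_; lookup)
open import Data.List using (List; []; _∷_; map; _++_; filterᵇ; length; allFin; upTo)
open import Data.Bool.ListAction using (and)
open import Data.Nat.ListAction using (sum)
open import Relation.Nullary.Decidable using (⌊_⌋)
open import Relation.Binary.PropositionalEquality using (_≡_)
import Data.Nat as N

record Graph (n : ℕ) : Set where
  field
    adj    : Fin n → Fin n → Bool
    sym    : ∀ i j → adj i j ≡ adj j i
    irrefl : ∀ i → adj i i ≡ false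
open Graph public

countFin : ∀ {n} → (Fin n → Bool) → ℕ
countFin {n} p = length (filterᵇ p (allFin n))

degree : ∀ {n} → Graph n → Fin n → ℕ
degree G i = countFin (adj G i)

Subset : ℕ → Set
Subset n = Vec Bool n

allSubsets : (n : ℕ) → List (Subset n)
allSubsets zero    = [] ∷ []
allSubsets (suc n) = map (false ∷_) (allSubsets n) ++ map (true ∷_) (allSubsets n)

size : ∀ {n} → Subset n → ℕ
size S = countFin (lookup S)

isClique : ∀ {n} → Graph n → Subset n → Bool
isClique {n} G S =
  and (map (λ i → and (map (λ j → not (lookup S i ∧ lookup S j ∧ not ⌊ i ≟ j ⌋) ∨ adj G i j)
                            (allFin n)))
           (allFin n))

-- k_t(G): number of copies of K_t in G (k_1(G) = |V(G)|, k_0(G) = 1)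
k : ℕ → ∀ {n} → Graph n → ℕ
k t {n} G = length (filterᵇ (λ S → (size S N.≡ᵇ t) ∧ isClique G S) (allSubsets n))

InClass : ℕ → ℕ → ∀ {n} → Graph n → Set
InClass Δ ω {n} G =
  (∀ (i : Fin n) → degree G i ≤ Δ) ×' (∀ (S : Subset n) → isClique G S ≡ true → size S ≤ ω)
  where
    open import Data.Product using () renaming (_×_ to _×'_)

-- Turán graph T_r(n): vertex i lies in part (i mod r); vertices are adjacent
-- iff they lie in different parts. Parts have sizes differing by at most one.
-- (For r = 0 we return the edgeless graph; it is never used with r = 0.)
turan : (r n : ℕ) → Graph n
turan zero n = record { adj = λ _ _ → false ; sym = λ _ _ → Relation.Binary.PropositionalEquality.refl ; irrefl = λ _ → Relation.Binary.PropositionalEquality.refl }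
  where import Relation.Binary.PropositionalEquality
turan (suc r) n = record { adj = a ; sym = s ; irrefl = ir }
  where
    open import Relation.Binary.PropositionalEquality using (refl; cong)
    a : Fin n → Fin n → Bool
    a i j = not ((toℕ i % suc r) N.≡ᵇ (toℕ j % suc r))
    s : ∀ i j → a i j ≡ a j i
    s i j = cong not (eqb-sym (toℕ i % suc r) (toℕ j % suc r))
      where
        eqb-sym : ∀ x y → (x N.≡ᵇ y) ≡ (y N.≡ᵇ x)
        eqb-sym zero zero = refl
        eqb-sym zero (suc y) = refl
        eqb-sym (suc x) zero = refl
        eqb-sym (suc x) (suc y) = eqb-sym x y
    ir : ∀ i → a i i ≡ false
    ir i = cong not (eqb-refl (toℕ i % suc r))
      where
        eqb-refl : ∀ x → (x N.≡ᵇ x) ≡ true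
        eqb-refl zero = refl
        eqb-refl (suc x) = eqb-refl x

-- The closed-form sum  Σ_{k=0}^{b} C(b,k) C(ω-1-b, t-1-k) (a+1)^k a^{t-1-k},
-- with binomial coefficients C(m,j) = 0 for j < 0 (i.e. k > t-1).
turanSum : (t ω a b : ℕ) → ℕ
turanSum t ω a b = sum (map term (upTo (suc b)))
  where
    term : ℕ → ℕ
    term i = if i ≤ᵇ (t ∸ 1)
             then (b C i) * ((ω ∸ 1 ∸ b) C (t ∸ 1 ∸ i)) * (suc a ^ i) * (a ^ (t ∸ 1 ∸ i))
             else 0

-- Double counting gives t · k_t(G) = Σ_v k_{t-1}(G[N(v)]). Each neighbourhood has at most Δ
-- vertices and, as G has no K_{ω+1}, contains no K_ω; by Zykov's theorem it therefore has at most
-- as many (t-1)-cliques as the Turán graph T_{ω-1}(Δ). Zykov's theorem is proved by induction on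
-- the clique bound r: take x of maximum degree d in U and delete the vertices outside N(x) one at
-- a time; each lies in at most e_{s-1}(T_{r-1}(d)) of the s-cliques, its neighbourhood being
-- K_r-free with at most d vertices. The resulting bound e_s of the partition (|U| - d, T_{r-1}(d))
-- is at most e_s(T_r(|U|)), since e_s of the part sizes grows when a unit moves from a larger part
-- to a smaller one. Finally k_s of a complete multipartite graph is e_s of its part sizes, which
-- for T_{ω-1}(Δ) expands into the stated binomial sum.

module Submission where

open import Algebra.Bundles using (CommutativeMonoid)
open import Data.Bool using (Bool; true; false; _∧_; _∨_; not; if_then_else_; T)
open import Data.Bool.ListAction using (and)
open import Data.Bool.Properties
  using (∧-assoc; ∧-zeroʳ; ∧-identityʳ; ∧-idem; ∧-conicalˡ; ∧-conicalʳ; ∧-commutativeMonoid;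
         ∨-distribˡ-∧; ∨-zeroʳ; ¬-not; not-involutive; T-≡)
open import Data.Empty using (⊥-elim)
open import Data.Fin using (Fin; zero; suc; toℕ; _≟_; inject₁; fromℕ)
open import Data.Fin.Properties using (any?; toℕ-inject₁; toℕ-fromℕ)
open import Data.List using (List; []; _∷_; _++_; map; filterᵇ; length; allFin; tabulate; replicate; applyUpTo)
open import Data.List.Extrema.Nat using (argmax; argmax-all; f[xs]≤f[argmax])
open import Data.List.Membership.Propositional.Properties using (∈-filter⁺; ∈-allFin)
open import Data.List.Properties using (++-identityʳ; filter-++; length-++; map-tabulate; map-upTo)
open import Data.List.Relation.Binary.Permutation.Propositional as ↭ using (_↭_)
open import Data.List.Relation.Binary.Permutation.Propositional.Properties using (shift)
import Data.List.Relation.Unary.All as All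
open import Data.List.Relation.Unary.All.Properties using (all-filter)
open import Data.Nat using (ℕ; zero; suc; _+_; _*_; _∸_; _^_; _≤_; _<_; _≤ᵇ_; _<ᵇ_; _≡ᵇ_; _%_; _/_; z≤n; s≤s)
open import Data.Nat.Combinatorics using (_C_; nCk+nC[k+1]≡[n+1]C[k+1]; k>n⇒nCk≡0)
open import Data.Nat.DivMod
  using (m≡m%n+[m/n]*n; m%n<n; m%n≤n; [m+kn]%n≡m%n; m<n⇒m%n≡m; m*n%n≡0; n%1≡0;
         +-distrib-/; m<n⇒m/n≡0; m*n/n≡m; n/1≡n; /-monoˡ-≤; m<n*o⇒m/o<n)
open import Data.Nat.ListAction using (sum)
open import Data.Nat.Properties hiding (_≟_)
open import Data.Nat.Solver using (module +-*-Solver)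
open import Data.Product using (∃; _×_; _,_; proj₁; proj₂)
open import Data.Sum using (_⊎_; inj₁; inj₂)
open import Data.Vec using ([]; _∷_; lookup)
open import Function using (_∘_; id; Equivalence)
open import Relation.Binary.PropositionalEquality
open import Relation.Nullary using (yes; no)
open import Relation.Nullary.Decidable using (⌊_⌋; T?)

open import Defs hiding (sym)
open +-*-Solver using (solve; _:+_; _:*_; _:=_; con)
open import Algebra.Properties.CommutativeMonoid.Sum +-0-commutativeMonoid
  using (sum-syntax; ∑-distrib-+; sum-cong-≗; sum-replicate-zero)
open import Algebra.Properties.CommutativeSemigroup +-commutativeSemigroup
  using () renaming (interchange to +-interchange; xy∙z≈xz∙y to +-swapʳ)
open import Algebra.Properties.CommutativeSemigroup (CommutativeMonoid.commutativeSemigroup ∧-commutativeMonoid)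
  using () renaming (interchange to ∧-interchange; xy∙z≈xz∙y to ∧-swapʳ)

private
  variable
    n : ℕ

𝟙 : Bool → ℕ
𝟙 false = 0
𝟙 true  = 1

infixr 7 _⊙_
_⊙_ : Bool → ℕ → ℕ
false ⊙ x = 0
true  ⊙ x = x

VSet : ℕ → Set
VSet n = Fin n → Bool

infixl 6 _∩_ _∖_ _-_
infix 4 _⊆_

_∩_ : VSet n → VSet n → VSet n
(U ∩ V) i = U i ∧ V i

_∖_ : VSet n → VSet n → VSet n
(U ∖ V) i = U i ∧ not (V i)

_-_ : VSet n → Fin n → VSet n
(U - v) i = U i ∧ not ⌊ i ≟ v ⌋

_⊆_ : VSet n → VSet n → Set
U ⊆ V = ∀ i → U i ≡ true → V i ≡ true

∩-monoˡ : {U V W : VSet n} → U ⊆ V → U ∩ W ⊆ V ∩ W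
∩-monoˡ {U = U} {W = W} U⊆V i U∩Wi =
  cong₂ _∧_ (U⊆V i (∧-conicalˡ (U i) (W i) U∩Wi)) (∧-conicalʳ (U i) (W i) U∩Wi)

-⊆ : (U : VSet n) (v : Fin n) → U - v ⊆ U
-⊆ U v i = ∧-conicalˡ (U i) _

Empty : VSet n → Set
Empty U = ∀ i → U i ≡ false

⌊suc≟suc⌋ : (i v : Fin n) → ⌊ suc i ≟ suc v ⌋ ≡ ⌊ i ≟ v ⌋
⌊suc≟suc⌋ i v with i ≟ v
... | yes _ = refl
... | no  _ = refl

≡ᵇ-true⇒≡ : ∀ {m n} → (m ≡ᵇ n) ≡ true → m ≡ n
≡ᵇ-true⇒≡ {m} {n} eq = ≡ᵇ⇒≡ m n (subst T (sym eq) _)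

-∘suc : (U : VSet (suc n)) (v : Fin n) → ∀ i → ((U ∘ suc) - v) i ≡ (U - suc v) (suc i)
-∘suc U v i = cong (λ b → U (suc i) ∧ not b) (sym (⌊suc≟suc⌋ i v))

count : VSet n → ℕ
count {zero}  U = 0
count {suc n} U = 𝟙 (U zero) + count (U ∘ suc)

count-cong : {U V : VSet n} → (∀ i → U i ≡ V i) → count U ≡ count V
count-cong {zero}  eq = refl
count-cong {suc n} eq = cong₂ _+_ (cong 𝟙 (eq zero)) (count-cong (eq ∘ suc))

count-empty : {U : VSet n} → Empty U → count U ≡ 0
count-empty {zero}  _ = refl
count-empty {suc n} e rewrite e zero = count-empty (e ∘ suc)

count≡0⇒empty : (U : VSet n) → count U ≡ 0 → Empty U
count≡0⇒empty {suc n} U eq zero    with U zero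
... | false = refl
count≡0⇒empty {suc n} U eq (suc i) with U zero
... | false = count≡0⇒empty (U ∘ suc) eq i

count-∩-∖ : (U V : VSet n) → count U ≡ count (U ∩ V) + count (U ∖ V)
count-∩-∖ {zero}  U V = refl
count-∩-∖ {suc n} U V = begin
    𝟙 (U zero) + count (U ∘ suc)
  ≡⟨ cong₂ _+_ (split (U zero) (V zero)) (count-∩-∖ (U ∘ suc) (V ∘ suc)) ⟩
    (𝟙 ((U ∩ V) zero) + 𝟙 ((U ∖ V) zero)) + (count ((U ∩ V) ∘ suc) + count ((U ∖ V) ∘ suc))
  ≡⟨ +-interchange (𝟙 ((U ∩ V) zero)) (𝟙 ((U ∖ V) zero)) _ _ ⟩
    count (U ∩ V) + count (U ∖ V) ∎
  where
    open ≡-Reasoning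
    split : ∀ a b → 𝟙 a ≡ 𝟙 (a ∧ b) + 𝟙 (a ∧ not b)
    split true  true  = refl
    split true  false = refl
    split false _     = refl

count-remove : (U : VSet n) (v : Fin n) → count U ≡ count (U - v) + 𝟙 (U v)
count-remove {suc n} U zero = begin
    𝟙 (U zero) + count (U ∘ suc)
  ≡⟨ +-comm (𝟙 (U zero)) _ ⟩
    count (U ∘ suc) + 𝟙 (U zero)
  ≡⟨ cong (_+ 𝟙 (U zero)) (count-cong (λ i → sym (∧-identityʳ (U (suc i))))) ⟩
    count ((U - zero) ∘ suc) + 𝟙 (U zero)
  ≡⟨ cong (λ b → 𝟙 b + count ((U - zero) ∘ suc) + 𝟙 (U zero)) (sym (∧-zeroʳ (U zero))) ⟩
    count (U - zero) + 𝟙 (U zero) ∎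
  where open ≡-Reasoning
count-remove {suc n} U (suc v) = begin
    𝟙 (U zero) + count (U ∘ suc)
  ≡⟨ cong₂ _+_ (cong 𝟙 (sym (∧-identityʳ (U zero)))) (count-remove (U ∘ suc) v) ⟩
    𝟙 ((U - suc v) zero) + (count ((U ∘ suc) - v) + 𝟙 (U (suc v)))
  ≡⟨ sym (+-assoc (𝟙 ((U - suc v) zero)) _ _) ⟩
    𝟙 ((U - suc v) zero) + count ((U ∘ suc) - v) + 𝟙 (U (suc v))
  ≡⟨ cong (λ m → 𝟙 ((U - suc v) zero) + m + 𝟙 (U (suc v))) (count-cong (-∘suc U v)) ⟩
    count (U - suc v) + 𝟙 (U (suc v)) ∎
  where open ≡-Reasoning

count-∖-remove : (U B : VSet n) {v : Fin n} → (U ∖ B) v ≡ true → count (U ∖ B) ≡ suc (count (U - v ∖ B))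
count-∖-remove U B {v} v∈U∖B = begin
    count (U ∖ B)
  ≡⟨ count-remove (U ∖ B) v ⟩
    count (U ∖ B - v) + 𝟙 ((U ∖ B) v)
  ≡⟨ cong₂ _+_ (count-cong (λ i → ∧-swapʳ (U i) _ _)) (cong 𝟙 v∈U∖B) ⟩
    count (U - v ∖ B) + 1
  ≡⟨ +-comm _ 1 ⟩
    suc (count (U - v ∖ B)) ∎
  where open ≡-Reasoning

⊆-remove : {B U : VSet n} {v : Fin n} → B ⊆ U → B v ≡ false → B ⊆ U - v
⊆-remove {U = U} {v} B⊆U v∉B i i∈B with i ≟ v
... | yes refl with () ← trans (sym i∈B) v∉B
... | no  _    = trans (∧-identityʳ (U i)) (B⊆U i i∈B)

⊆-∖-empty : {B U : VSet n} → B ⊆ U → Empty (U ∖ B) → ∀ i → U i ≡ B i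
⊆-∖-empty {B = B} {U} B⊆U empty i with B i in i∈B
... | true  = B⊆U i i∈B
... | false = trans (sym (∧-identityʳ (U i))) (trans (cong (λ b → U i ∧ not b) (sym i∈B)) (empty i))

empty-or-member : (U : VSet n) → Empty U ⊎ ∃ λ v → U v ≡ true
empty-or-member U with any? (λ i → U i Data.Bool.≟ true)
... | yes member = inj₂ member
... | no  none   = inj₁ (λ i → ¬-not (λ eq → none (i , eq)))

maximiser : (U : VSet n) (g : Fin n → ℕ) → ∃ (λ v → U v ≡ true) →
            ∃ λ x → U x ≡ true × (∀ v → U v ≡ true → g v ≤ g x)
maximiser {n} U g (v , Uv) =
  x , argmax-all g Uv (All.map (Equivalence.to T-≡) (all-filter (T? ∘ U) (allFin n))) ,
  λ w Uw → All.lookup (f[xs]≤f[argmax] v members)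
                      (∈-filter⁺ (T? ∘ U) (∈-allFin w) (Equivalence.from T-≡ Uw))
  where
    members = filterᵇ U (allFin n)
    x = argmax g v members

⊙-one : ∀ b → b ⊙ 1 ≡ 𝟙 b
⊙-one false = refl
⊙-one true  = refl

⊙-distribˡ-+ : ∀ b x y → b ⊙ (x + y) ≡ b ⊙ x + b ⊙ y
⊙-distribˡ-+ false x y = refl
⊙-distribˡ-+ true  x y = refl

⊙-∧-exchange : ∀ u w a x → u ⊙ ((w ∧ a) ⊙ x) ≡ w ⊙ ((u ∧ a) ⊙ x)
⊙-∧-exchange false false a x = refl
⊙-∧-exchange false true  a x = refl
⊙-∧-exchange true  false a x = refl
⊙-∧-exchange true  true  a x = refl

⊙-mono-≤ : ∀ {b c x y} → (b ≡ true → c ≡ true) → x ≤ y → b ⊙ x ≤ c ⊙ y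
⊙-mono-≤ {false} _ _ = z≤n
⊙-mono-≤ {true} b⇒c x≤y rewrite b⇒c refl = x≤y

∑-⊙ : ∀ b (f : Fin n → ℕ) → ∑[ i < n ] (b ⊙ f i) ≡ b ⊙ ∑[ i < n ] f i
∑-⊙ {n} false f = sum-replicate-zero n
∑-⊙     true  f = refl

∑-indicator : (U : VSet n) → ∑[ i < n ] (U i ⊙ 1) ≡ count U
∑-indicator {zero}  U = refl
∑-indicator {suc n} U = cong₂ _+_ (⊙-one (U zero)) (∑-indicator (U ∘ suc))

∑-mono-≤ : (f g : Fin n → ℕ) → (∀ i → f i ≤ g i) → ∑[ i < n ] f i ≤ ∑[ i < n ] g i
∑-mono-≤ {zero}  f g f≤g = z≤n
∑-mono-≤ {suc n} f g f≤g = +-mono-≤ (f≤g zero) (∑-mono-≤ (f ∘ suc) (g ∘ suc) (f≤g ∘ suc))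

∑-const : ∀ c → ∑[ i < n ] c ≡ n * c
∑-const {zero}  c = refl
∑-const {suc n} c = cong (c +_) (∑-const {n} c)

tail : Graph (suc n) → Graph n
tail G = record
  { adj    = λ i j → adj G (suc i) (suc j)
  ; sym    = λ i j → Graph.sym G (suc i) (suc j)
  ; irrefl = irrefl G ∘ suc
  }

-- The number of s-cliques of G inside U, split by whether they use vertex 0.
cliques : Graph n → VSet n → ℕ → ℕ
cliques         G U zero    = 1
cliques {zero}  G U (suc s) = 0
cliques {suc n} G U (suc s) =
  cliques (tail G) (U ∘ suc) (suc s) + U zero ⊙ cliques (tail G) ((U ∩ adj G zero) ∘ suc) s

cliques-cong : (G : Graph n) {U V : VSet n} → (∀ i → U i ≡ V i) → ∀ s → cliques G U s ≡ cliques G V s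
cliques-cong         G U≗V zero    = refl
cliques-cong {zero}  G U≗V (suc s) = refl
cliques-cong {suc n} G U≗V (suc s) =
  cong₂ _+_ (cliques-cong (tail G) (U≗V ∘ suc) (suc s))
            (cong₂ _⊙_ (U≗V zero) (cliques-cong (tail G) (λ i → cong (_∧ _) (U≗V (suc i))) s))

cliques-mono : (G : Graph n) {U V : VSet n} → U ⊆ V → ∀ s → cliques G U s ≤ cliques G V s
cliques-mono         G U⊆V zero    = ≤-refl
cliques-mono {zero}  G U⊆V (suc s) = ≤-refl
cliques-mono {suc n} G U⊆V (suc s) =
  +-mono-≤ (cliques-mono (tail G) (U⊆V ∘ suc) (suc s))
           (⊙-mono-≤ (U⊆V zero) (cliques-mono (tail G) (∩-monoˡ {W = adj G zero} U⊆V ∘ suc) s))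

cliques-skip₀ : (G : Graph (suc n)) (U : VSet (suc n)) → U zero ≡ false →
                ∀ s → cliques G U s ≡ cliques (tail G) (U ∘ suc) s
cliques-skip₀ G U U₀ zero    = refl
cliques-skip₀ G U U₀ (suc s) rewrite U₀ = +-identityʳ _

cliques-empty : (G : Graph n) {U : VSet n} → Empty U → ∀ s → cliques G U (suc s) ≡ 0
cliques-empty {zero}  G e s = refl
cliques-empty {suc n} G e s rewrite e zero = trans (+-identityʳ _) (cliques-empty (tail G) (e ∘ suc) s)

cliques-one : (G : Graph n) (U : VSet n) → cliques G U 1 ≡ count U
cliques-one {zero}  G U = refl
cliques-one {suc n} G U = begin
    cliques (tail G) (U ∘ suc) 1 + U zero ⊙ 1
  ≡⟨ cong₂ _+_ (cliques-one (tail G) (U ∘ suc)) (⊙-one (U zero)) ⟩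
    count (U ∘ suc) + 𝟙 (U zero)
  ≡⟨ +-comm (count (U ∘ suc)) _ ⟩
    count U ∎
  where open ≡-Reasoning

self-∉-neighbourhood : (G : Graph n) (U : VSet n) (v : Fin n) → (U ∩ adj G v) v ≡ false
self-∉-neighbourhood G U v = trans (cong (U v ∧_) (irrefl G v)) (∧-zeroʳ (U v))

-- The cliques through vertex suc v, split by whether they also use vertex 0.
cliques-through-suc : (G : Graph (suc n)) (U : VSet (suc n)) (v : Fin n) (s : ℕ) →
  let H = tail G; W = (U ∩ adj G zero) ∘ suc in
  U (suc v) ⊙ cliques G (U ∩ adj G (suc v)) (suc s)
    ≡ (U ∘ suc) v ⊙ cliques H ((U ∘ suc) ∩ adj H v) (suc s) + U zero ⊙ (W v ⊙ cliques H (W ∩ adj H v) s)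
cliques-through-suc G U v s =
  trans (⊙-distribˡ-+ (U (suc v)) _ _)
        (cong (U (suc v) ⊙ cliques (tail G) ((U ∘ suc) ∩ adj (tail G) v) (suc s) +_) (sym through-0))
  where
    A₀ = adj G zero
    W = (U ∩ A₀) ∘ suc
    through-0 : U zero ⊙ ((U (suc v) ∧ A₀ (suc v)) ⊙ cliques (tail G) (W ∩ adj (tail G) v) s)
              ≡ U (suc v) ⊙ ((U zero ∧ adj G (suc v) zero) ⊙ cliques (tail G) ((U ∩ adj G (suc v) ∩ A₀) ∘ suc) s)
    through-0 = trans (⊙-∧-exchange (U zero) (U (suc v)) (A₀ (suc v)) _)
      (cong₂ (λ a x → U (suc v) ⊙ ((U zero ∧ a) ⊙ x)) (Graph.sym G zero (suc v))
             (cliques-cong (tail G) (λ i → ∧-swapʳ (U (suc i)) (A₀ (suc i)) _) s))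

cliques-remove : (G : Graph n) (U : VSet n) (v : Fin n) (s : ℕ) →
  cliques G U (suc s) ≡ cliques G (U - v) (suc s) + U v ⊙ cliques G (U ∩ adj G v) s
cliques-remove {suc n} G U zero s =
  cong₂ _+_ (sym (trans (cliques-skip₀ G (U - zero) (∧-zeroʳ (U zero)) (suc s))
                        (cliques-cong (tail G) (∧-identityʳ ∘ U ∘ suc) (suc s))))
            (cong (U zero ⊙_) (sym (cliques-skip₀ G (U ∩ adj G zero) (self-∉-neighbourhood G U zero) s)))
cliques-remove G U v zero = begin
    cliques G U 1
  ≡⟨ cliques-one G U ⟩
    count U
  ≡⟨ count-remove U v ⟩
    count (U - v) + 𝟙 (U v)
  ≡⟨ cong₂ _+_ (sym (cliques-one G (U - v))) (sym (⊙-one (U v))) ⟩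
    cliques G (U - v) 1 + U v ⊙ 1 ∎
  where open ≡-Reasoning
cliques-remove {suc n} G U (suc v) (suc s) = begin
    cliques H U′ (2 + s) + u₀ ⊙ cliques H W (1 + s)
  ≡⟨ cong₂ (λ x y → x + u₀ ⊙ y) (cliques-remove H U′ v (1 + s)) (cliques-remove H W v s) ⟩
    (cliques H (U′ - v) (2 + s) + U′ v ⊙ cliques H (U′ ∩ adj H v) (1 + s))
      + u₀ ⊙ (cliques H (W - v) (1 + s) + W v ⊙ cliques H (W ∩ adj H v) s)
  ≡⟨ cong (cliques H (U′ - v) (2 + s) + U′ v ⊙ cliques H (U′ ∩ adj H v) (1 + s) +_)
          (⊙-distribˡ-+ u₀ _ _) ⟩
    (cliques H (U′ - v) (2 + s) + U′ v ⊙ cliques H (U′ ∩ adj H v) (1 + s))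
      + (u₀ ⊙ cliques H (W - v) (1 + s) + u₀ ⊙ (W v ⊙ cliques H (W ∩ adj H v) s))
  ≡⟨ +-interchange (cliques H (U′ - v) (2 + s)) (U′ v ⊙ cliques H (U′ ∩ adj H v) (1 + s)) _ _ ⟩
    (cliques H (U′ - v) (2 + s) + u₀ ⊙ cliques H (W - v) (1 + s))
      + (U′ v ⊙ cliques H (U′ ∩ adj H v) (1 + s) + u₀ ⊙ (W v ⊙ cliques H (W ∩ adj H v) s))
  ≡⟨ cong₂ _+_ without-v (sym (cliques-through-suc G U v s)) ⟩
    cliques G (U - suc v) (2 + s) + U′ v ⊙ cliques G (U ∩ adj G (suc v)) (1 + s) ∎
  where
    open ≡-Reasoning
    H = tail G
    A₀ = adj G zero
    u₀ = U zero
    U′ = U ∘ suc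
    W = (U ∩ A₀) ∘ suc
    without-v : cliques H (U′ - v) (2 + s) + u₀ ⊙ cliques H (W - v) (1 + s)
              ≡ cliques G (U - suc v) (2 + s)
    without-v = begin
        cliques H (U′ - v) (2 + s) + u₀ ⊙ cliques H (W - v) (1 + s)
      ≡⟨ cong₂ (λ x y → x + u₀ ⊙ y) (cliques-cong H (-∘suc U v) (2 + s)) (cliques-cong H W-v (1 + s)) ⟩
        cliques H ((U - suc v) ∘ suc) (2 + s) + u₀ ⊙ cliques H ((U - suc v ∩ A₀) ∘ suc) (1 + s)
      ≡⟨ cong (λ b → cliques H ((U - suc v) ∘ suc) (2 + s) + b ⊙ cliques H ((U - suc v ∩ A₀) ∘ suc) (1 + s))
              (sym (∧-identityʳ u₀)) ⟩
        cliques G (U - suc v) (2 + s) ∎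
      where
        W-v : ∀ i → (W - v) i ≡ (U - suc v ∩ A₀) (suc i)
        W-v i = trans (∧-swapʳ (U′ i) (A₀ (suc i)) _) (cong (_∧ A₀ (suc i)) (-∘suc U v i))

cliques-double-count : (G : Graph n) (U : VSet n) (s : ℕ) →
  suc s * cliques G U (suc s) ≡ ∑[ v < n ] (U v ⊙ cliques G (U ∩ adj G v) s)
cliques-double-count {zero}  G U s    = *-zeroʳ (suc s)
cliques-double-count         G U zero = trans (+-identityʳ _) (trans (cliques-one G U) (sym (∑-indicator U)))
cliques-double-count {suc n} G U (suc s) = sym (begin
    U zero ⊙ cliques G (U ∩ A₀) (1 + s) + ∑[ v < n ] (U (suc v) ⊙ cliques G (U ∩ adj G (suc v)) (1 + s))
  ≡⟨ cong₂ _+_ (cong (U zero ⊙_) (cliques-skip₀ G (U ∩ A₀) (self-∉-neighbourhood G U zero) (1 + s)))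
               (sum-cong-≗ (λ v → cliques-through-suc G U v s)) ⟩
    U zero ⊙ cliques H W (1 + s)
      + ∑[ v < n ] (U′ v ⊙ cliques H (U′ ∩ adj H v) (1 + s) + U zero ⊙ (W v ⊙ cliques H (W ∩ adj H v) s))
  ≡⟨ cong (U zero ⊙ cliques H W (1 + s) +_)
       (trans (∑-distrib-+ (λ v → U′ v ⊙ cliques H (U′ ∩ adj H v) (1 + s)) _)
              (cong (∑[ v < n ] (U′ v ⊙ cliques H (U′ ∩ adj H v) (1 + s)) +_)
                    (∑-⊙ (U zero) (λ v → W v ⊙ cliques H (W ∩ adj H v) s)))) ⟩
    U zero ⊙ cliques H W (1 + s)
      + (∑[ v < n ] (U′ v ⊙ cliques H (U′ ∩ adj H v) (1 + s))
         + U zero ⊙ ∑[ v < n ] (W v ⊙ cliques H (W ∩ adj H v) s))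
  ≡⟨ cong (λ x → U zero ⊙ cliques H W (1 + s) + x)
       (cong₂ (λ x y → x + U zero ⊙ y) (sym (cliques-double-count H U′ (1 + s)))
                                       (sym (cliques-double-count H W s))) ⟩
    U zero ⊙ cliques H W (1 + s) + ((2 + s) * cliques H U′ (2 + s) + U zero ⊙ ((1 + s) * cliques H W (1 + s)))
  ≡⟨ regroup (U zero) (cliques H W (1 + s)) (cliques H U′ (2 + s)) ⟩
    (2 + s) * cliques G U (2 + s) ∎)
  where
    open ≡-Reasoning
    H = tail G
    A₀ = adj G zero
    U′ = U ∘ suc
    W = (U ∩ A₀) ∘ suc
    regroup : ∀ b x y → b ⊙ x + ((2 + s) * y + b ⊙ ((1 + s) * x)) ≡ (2 + s) * (y + b ⊙ x)
    regroup false x y = trans (+-identityʳ _) (cong ((2 + s) *_) (sym (+-identityʳ y)))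
    regroup true  x y =
      solve 3 (λ s x y → x :+ ((con 2 :+ s) :* y :+ (con 1 :+ s) :* x) := (con 2 :+ s) :* (y :+ x)) refl s x y

cliques-peel : (G : Graph n) {s X : ℕ} (B W : VSet n) → B ⊆ W →
  (∀ v → W v ≡ true → cliques G (W ∩ adj G v) s ≤ X) →
  cliques G W (suc s) ≤ cliques G B (suc s) + count (W ∖ B) * X
cliques-peel G {s} {X} B W B⊆W bound = peel (count (W ∖ B)) W B⊆W bound refl
  where
    peel : ∀ k W → B ⊆ W → (∀ v → W v ≡ true → cliques G (W ∩ adj G v) s ≤ X) →
           count (W ∖ B) ≡ k → cliques G W (suc s) ≤ cliques G B (suc s) + k * X
    peel zero W B⊆W _ |W∖B| =
      ≤-reflexive (trans (cliques-cong G (⊆-∖-empty B⊆W (count≡0⇒empty (W ∖ B) |W∖B|)) (suc s))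
                         (sym (+-identityʳ _)))
    peel (suc k) W B⊆W bound |W∖B| with empty-or-member (W ∖ B)
    ... | inj₁ empty with () ← trans (sym (count-empty empty)) |W∖B|
    ... | inj₂ (v , v∈W∖B) = begin
        cliques G W (suc s)
      ≡⟨ cliques-remove G W v s ⟩
        cliques G (W - v) (suc s) + W v ⊙ cliques G (W ∩ adj G v) s
      ≡⟨ cong (λ b → cliques G (W - v) (suc s) + b ⊙ cliques G (W ∩ adj G v) s) v∈W ⟩
        cliques G (W - v) (suc s) + cliques G (W ∩ adj G v) s
      ≤⟨ +-mono-≤ (peel k (W - v) (⊆-remove B⊆W v∉B) bound-v |W-v∖B|) (bound v v∈W) ⟩
        cliques G B (suc s) + k * X + X
      ≡⟨ trans (+-assoc _ (k * X) X) (cong (cliques G B (suc s) +_) (+-comm (k * X) X)) ⟩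
        cliques G B (suc s) + suc k * X ∎
      where
        open ≤-Reasoning
        v∈W : W v ≡ true
        v∈W = ∧-conicalˡ _ _ v∈W∖B
        v∉B : B v ≡ false
        v∉B = trans (sym (not-involutive (B v))) (cong not (∧-conicalʳ _ _ v∈W∖B))
        bound-v : ∀ u → (W - v) u ≡ true → cliques G (W - v ∩ adj G u) s ≤ X
        bound-v u u∈W-v = ≤-trans (cliques-mono G (∩-monoˡ (-⊆ W v)) s) (bound u (-⊆ W v u u∈W-v))
        |W-v∖B| : count (W - v ∖ B) ≡ k
        |W-v∖B| = suc-injective (trans (sym (count-∖-remove W B v∈W∖B)) |W∖B|)

module _ {A : Set} (p : A → Bool) where

  length-filterᵇ-∷ : ∀ x xs → length (filterᵇ p (x ∷ xs)) ≡ 𝟙 (p x) + length (filterᵇ p xs)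
  length-filterᵇ-∷ x xs with p x
  ... | true  = refl
  ... | false = refl

  length-filterᵇ-++ : ∀ xs ys → length (filterᵇ p (xs ++ ys)) ≡ length (filterᵇ p xs) + length (filterᵇ p ys)
  length-filterᵇ-++ xs ys = trans (cong length (filter-++ (T? ∘ p) xs ys)) (length-++ (filterᵇ p xs))

length-filterᵇ-cong : {A : Set} {p q : A → Bool} → (∀ x → p x ≡ q x) → ∀ xs →
                      length (filterᵇ p xs) ≡ length (filterᵇ q xs)
length-filterᵇ-cong         eq []       = refl
length-filterᵇ-cong {p = p} {q} eq (x ∷ xs) = begin
  length (filterᵇ p (x ∷ xs))            ≡⟨ length-filterᵇ-∷ p x xs ⟩
  𝟙 (p x) + length (filterᵇ p xs)        ≡⟨ cong₂ _+_ (cong 𝟙 (eq x)) (length-filterᵇ-cong eq xs) ⟩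
  𝟙 (q x) + length (filterᵇ q xs)        ≡⟨ length-filterᵇ-∷ q x xs ⟨
  length (filterᵇ q (x ∷ xs))            ∎
  where open ≡-Reasoning

length-filterᵇ-map : {A B : Set} (p : B → Bool) (f : A → B) (xs : List A) →
                     length (filterᵇ p (map f xs)) ≡ length (filterᵇ (p ∘ f) xs)
length-filterᵇ-map p f []       = refl
length-filterᵇ-map p f (x ∷ xs) =
  trans (length-filterᵇ-∷ p (f x) (map f xs))
        (trans (cong (𝟙 (p (f x)) +_) (length-filterᵇ-map p f xs)) (sym (length-filterᵇ-∷ (p ∘ f) x xs)))

length-filterᵇ-tabulate : {A : Set} (p : A → Bool) (g : Fin n → A) →
  length (filterᵇ p (tabulate g)) ≡ count (p ∘ g)
length-filterᵇ-tabulate {zero}  p g = refl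
length-filterᵇ-tabulate {suc n} p g =
  trans (length-filterᵇ-∷ p (g zero) _) (cong (𝟙 (p (g zero)) +_) (length-filterᵇ-tabulate p (g ∘ suc)))

countFin≡count : (U : VSet n) → countFin U ≡ count U
countFin≡count U = length-filterᵇ-tabulate U id

allᶠ : VSet n → Bool
allᶠ {zero}  U = true
allᶠ {suc n} U = U zero ∧ allᶠ (U ∘ suc)

and-tabulate : (f : Fin n → Bool) → and (tabulate f) ≡ allᶠ f
and-tabulate {zero}  f = refl
and-tabulate {suc n} f = cong (f zero ∧_) (and-tabulate (f ∘ suc))

and-map-allFin : (f : Fin n → Bool) → and (map f (allFin n)) ≡ allᶠ f
and-map-allFin f = trans (cong and (map-tabulate id f)) (and-tabulate f)

allᶠ-cong : {f g : VSet n} → (∀ i → f i ≡ g i) → allᶠ f ≡ allᶠ g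
allᶠ-cong {zero}  eq = refl
allᶠ-cong {suc n} eq = cong₂ _∧_ (eq zero) (allᶠ-cong (eq ∘ suc))

allᶠ-true : allᶠ {n} (λ _ → true) ≡ true
allᶠ-true {zero}  = refl
allᶠ-true {suc n} = allᶠ-true {n}

allᶠ-∧ : (f g : VSet n) → allᶠ (f ∩ g) ≡ allᶠ f ∧ allᶠ g
allᶠ-∧ {zero}  f g = refl
allᶠ-∧ {suc n} f g = trans (cong ((f zero ∧ g zero) ∧_) (allᶠ-∧ (f ∘ suc) (g ∘ suc)))
                           (∧-interchange (f zero) (g zero) _ _)

within : VSet n → Subset n → Bool
within U S = allᶠ (λ j → not (lookup S j) ∨ U j)

within-∩ : (U V : VSet n) (S : Subset n) → within (U ∩ V) S ≡ within U S ∧ within V S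
within-∩ U V S = trans (allᶠ-cong (λ j → ∨-distribˡ-∧ (not (lookup S j)) (U j) (V j)))
                       (allᶠ-∧ (λ j → not (lookup S j) ∨ U j) (λ j → not (lookup S j) ∨ V j))

within-everything : (S : Subset n) → within (λ _ → true) S ≡ true
within-everything {n} S = trans (allᶠ-cong (λ j → ∨-zeroʳ (not (lookup S j)))) (allᶠ-true {n})

compatible : Graph n → Subset n → Fin n → Fin n → Bool
compatible G S i j = not (lookup S i ∧ lookup S j ∧ not ⌊ i ≟ j ⌋) ∨ adj G i j

cliqueᵇ : Graph n → Subset n → Bool
cliqueᵇ G S = allᶠ (λ i → allᶠ (compatible G S i))

isClique≡cliqueᵇ : (G : Graph n) (S : Subset n) → isClique G S ≡ cliqueᵇ G S
isClique≡cliqueᵇ {n} G S =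
  trans (and-map-allFin (λ i → and (map (compatible G S i) (allFin n))))
        (allᶠ-cong (λ i → and-map-allFin (compatible G S i)))

compatible-suc : (G : Graph (suc n)) (b : Bool) (S : Subset n) (i j : Fin n) →
                 compatible G (b ∷ S) (suc i) (suc j) ≡ compatible (tail G) S i j
compatible-suc G b S i j =
  cong (λ x → not (lookup S i ∧ lookup S j ∧ not x) ∨ adj G (suc i) (suc j)) (⌊suc≟suc⌋ i j)

cliqueᵇ-false : (G : Graph (suc n)) (S : Subset n) → cliqueᵇ G (false ∷ S) ≡ cliqueᵇ (tail G) S
cliqueᵇ-false {n} G S = cong₂ _∧_ (allᶠ-true {n})
  (allᶠ-cong (λ i → cong₂ _∧_ (outside (lookup S i) _) (allᶠ-cong (compatible-suc G false S i))))
  where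
    outside : ∀ a x → not (a ∧ false ∧ true) ∨ x ≡ true
    outside true  x = refl
    outside false x = refl

cliqueᵇ-true : (G : Graph (suc n)) (S : Subset n) →
               cliqueᵇ G (true ∷ S) ≡ within (adj G zero ∘ suc) S ∧ cliqueᵇ (tail G) S
cliqueᵇ-true G S = begin
    cliqueᵇ G (true ∷ S)
  ≡⟨ cong₂ _∧_ (allᶠ-cong (λ j → cong (λ a → not a ∨ adj G zero (suc j)) (∧-identityʳ (lookup S j))))
               (allᶠ-cong (λ i → cong₂ _∧_ (cong₂ (λ a b → not a ∨ b) (∧-identityʳ (lookup S i))
                                                                    (Graph.sym G (suc i) zero))
                                           (allᶠ-cong (compatible-suc G true S i)))) ⟩
    X ∧ allᶠ (λ i → (not (lookup S i) ∨ adj G zero (suc i)) ∧ allᶠ (compatible (tail G) S i))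
  ≡⟨ cong (X ∧_) (allᶠ-∧ (λ i → not (lookup S i) ∨ adj G zero (suc i)) _) ⟩
    X ∧ (X ∧ cliqueᵇ (tail G) S)
  ≡⟨ ∧-assoc X X _ ⟨
    (X ∧ X) ∧ cliqueᵇ (tail G) S
  ≡⟨ cong (_∧ cliqueᵇ (tail G) S) (∧-idem X) ⟩
    X ∧ cliqueᵇ (tail G) S ∎
  where
    open ≡-Reasoning
    X = within (adj G zero ∘ suc) S

subsets : (Subset n → Bool) → ℕ
subsets {n} P = length (filterᵇ P (allSubsets n))

subsets-cong : {P Q : Subset n → Bool} → (∀ S → P S ≡ Q S) → subsets P ≡ subsets Q
subsets-cong {n} eq = length-filterᵇ-cong eq (allSubsets n)

subsets-suc : (P : Subset (suc n) → Bool) → subsets P ≡ subsets (P ∘ (false ∷_)) + subsets (P ∘ (true ∷_))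
subsets-suc {n} P = trans (length-filterᵇ-++ P (map (false ∷_) (allSubsets n)) _)
  (cong₂ _+_ (length-filterᵇ-map P (false ∷_) (allSubsets n)) (length-filterᵇ-map P (true ∷_) (allSubsets n)))

subsets-none : {P : Subset n → Bool} → (∀ S → P S ≡ false) → subsets P ≡ 0
subsets-none {n} {P} none = go (allSubsets n)
  where
    go : ∀ xs → length (filterᵇ P xs) ≡ 0
    go []       = refl
    go (S ∷ xs) = trans (length-filterᵇ-∷ P S xs) (cong₂ _+_ (cong 𝟙 (none S)) (go xs))

subsets-∧ : ∀ b (P : Subset n → Bool) → subsets (λ S → b ∧ P S) ≡ b ⊙ subsets P
subsets-∧ {n} false P = subsets-none {n} (λ _ → refl)
subsets-∧ true  P = refl

size-∷ : ∀ b (S : Subset n) → size (b ∷ S) ≡ 𝟙 b + size S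
size-∷ b S = trans (countFin≡count (lookup (b ∷ S))) (cong (𝟙 b +_) (sym (countFin≡count (lookup S))))

isCliqueOfSize : Graph n → VSet n → ℕ → Subset n → Bool
isCliqueOfSize G U s S = (size S ≡ᵇ s) ∧ (within U S ∧ cliqueᵇ G S)

cliques-subsets : (G : Graph n) (U : VSet n) (s : ℕ) → subsets (isCliqueOfSize G U s) ≡ cliques G U s
cliques-subsets {zero}  G U zero    = refl
cliques-subsets {zero}  G U (suc s) = refl
cliques-subsets {suc n} G U s = trans (subsets-suc (isCliqueOfSize G U s)) (split s)
  where
    H = tail G
    W = (U ∩ adj G zero) ∘ suc
    P : Bool → ℕ → Subset n → Bool
    P b s S = isCliqueOfSize G U s (b ∷ S)

    avoiding-0 : ∀ s → subsets (P false s) ≡ cliques H (U ∘ suc) s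
    avoiding-0 s = trans (subsets-cong (λ S → cong₂ (λ m c → (m ≡ᵇ s) ∧ (within (U ∘ suc) S ∧ c))
                                                     (size-∷ false S) (cliqueᵇ-false G S)))
                         (cliques-subsets H (U ∘ suc) s)

    regroup : ∀ e u w m c → e ∧ ((u ∧ w) ∧ (m ∧ c)) ≡ u ∧ (e ∧ ((w ∧ m) ∧ c))
    regroup false u     w m c = sym (∧-zeroʳ u)
    regroup true  false w m c = refl
    regroup true  true  w m c = sym (∧-assoc w m c)

    using-0 : ∀ s → subsets (P true (suc s)) ≡ U zero ⊙ cliques H W s
    using-0 s = begin
        subsets (P true (suc s))
      ≡⟨ subsets-cong (λ S → cong₂ (λ m c → (m ≡ᵇ suc s) ∧ (within U (true ∷ S) ∧ c))
                                   (size-∷ true S) (cliqueᵇ-true G S)) ⟩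
        subsets (λ S → (size S ≡ᵇ s) ∧ ((U zero ∧ within (U ∘ suc) S) ∧ (within (adj G zero ∘ suc) S ∧ cliqueᵇ H S)))
      ≡⟨ subsets-cong (λ S → trans (regroup (size S ≡ᵇ s) (U zero) _ _ _)
                                   (cong (λ w → U zero ∧ ((size S ≡ᵇ s) ∧ (w ∧ cliqueᵇ H S)))
                                         (sym (within-∩ (U ∘ suc) (adj G zero ∘ suc) S)))) ⟩
        subsets (λ S → U zero ∧ isCliqueOfSize H W s S)
      ≡⟨ subsets-∧ (U zero) (isCliqueOfSize H W s) ⟩
        U zero ⊙ subsets (isCliqueOfSize H W s)
      ≡⟨ cong (U zero ⊙_) (cliques-subsets H W s) ⟩
        U zero ⊙ cliques H W s ∎
      where open ≡-Reasoning

    split : ∀ s → subsets (P false s) + subsets (P true s) ≡ cliques G U s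
    split zero    = cong₂ _+_ (avoiding-0 zero)
                              (subsets-none (λ S → cong (λ m → (m ≡ᵇ 0) ∧ (within U (true ∷ S) ∧ cliqueᵇ G (true ∷ S)))
                                                        (size-∷ true S)))
    split (suc s) = cong₂ _+_ (avoiding-0 (suc s)) (using-0 s)

k≡cliques : ∀ s (G : Graph n) → k s G ≡ cliques G (λ _ → true) s
k≡cliques s G = trans (subsets-cong (λ S → cong ((size S ≡ᵇ s) ∧_)
                        (trans (isClique≡cliqueᵇ G S) (cong (_∧ cliqueᵇ G S) (sym (within-everything S))))))
                      (cliques-subsets G (λ _ → true) s)

no-larger-cliques : ∀ ω (G : Graph n) → (∀ S → isClique G S ≡ true → size S ≤ ω) → k (suc ω) G ≡ 0
no-larger-cliques ω G small = subsets-none none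
  where
    none : ∀ S → (size S ≡ᵇ suc ω) ∧ isClique G S ≡ false
    none S with isClique G S in clique
    ... | false = ∧-zeroʳ _
    ... | true with size S ≡ᵇ suc ω in |S|≡ω+1
    ...   | false = refl
    ...   | true  = ⊥-elim (<-irrefl refl (subst (_≤ ω) (≡ᵇ-true⇒≡ |S|≡ω+1) (small S clique)))


-- Elementary symmetric polynomials

-- esym xs s is the elementary symmetric polynomial e_s of the numbers xs, which is also
-- the number of s-cliques of the complete multipartite graph with part sizes xs.
esym : List ℕ → ℕ → ℕ
esym xs       zero    = 1
esym []       (suc s) = 0
esym (x ∷ xs) (suc s) = esym xs (suc s) + x * esym xs s

esym-swap : ∀ x y xs s → esym (x ∷ y ∷ xs) s ≡ esym (y ∷ x ∷ xs) s
esym-swap x y xs zero          = refl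
esym-swap x y xs (suc zero)    =
  solve 3 (λ e x y → e :+ y :* con 1 :+ x :* con 1 := e :+ x :* con 1 :+ y :* con 1) refl (esym xs 1) x y
esym-swap x y xs (suc (suc s)) =
  solve 5 (λ a b c x y → a :+ y :* b :+ x :* (b :+ y :* c) := a :+ x :* b :+ y :* (b :+ x :* c)) refl
          (esym xs (2 + s)) (esym xs (1 + s)) (esym xs s) x y

esym-∷-cong : ∀ x {xs ys} → (∀ s → esym xs s ≡ esym ys s) → ∀ s → esym (x ∷ xs) s ≡ esym (x ∷ ys) s
esym-∷-cong x eq zero    = refl
esym-∷-cong x eq (suc s) = cong₂ (λ a b → a + x * b) (eq (suc s)) (eq s)

esym-↭ : {xs ys : List ℕ} → xs ↭ ys → ∀ s → esym xs s ≡ esym ys s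
esym-↭ ↭.refl           s = refl
esym-↭ (↭.prep x p)       = esym-∷-cong x (esym-↭ p)
esym-↭ (↭.swap x y p)   s = trans (esym-∷-cong x (esym-∷-cong y (esym-↭ p)) s) (esym-swap x y _ s)
esym-↭ (↭.trans p q)    s = trans (esym-↭ p s) (esym-↭ q s)

esym-monoˡ-≤ : ∀ {x y} xs → x ≤ y → ∀ s → esym (x ∷ xs) s ≤ esym (y ∷ xs) s
esym-monoˡ-≤ xs x≤y zero    = ≤-refl
esym-monoˡ-≤ xs x≤y (suc s) = +-monoʳ-≤ (esym xs (suc s)) (*-monoˡ-≤ (esym xs s) x≤y)

esym-transfer : ∀ {u v} xs → u ≤ v → ∀ s → esym (u ∷ suc v ∷ xs) s ≤ esym (suc u ∷ v ∷ xs) s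
esym-transfer xs u≤v zero          = ≤-refl
esym-transfer {u} {v} xs u≤v (suc zero) = ≤-reflexive
  (solve 3 (λ e u v → e :+ (con 1 :+ v) :* con 1 :+ u :* con 1 := e :+ v :* con 1 :+ (con 1 :+ u) :* con 1)
           refl (esym xs 1) u v)
esym-transfer {u} {v} xs u≤v (suc (suc s)) = begin
    a + suc v * b + u * (b + suc v * c)
  ≡⟨ solve 5 (λ a b c u v → a :+ (con 1 :+ v) :* b :+ u :* (b :+ (con 1 :+ v) :* c)
                         := (a :+ (con 1 :+ u :+ v) :* b :+ u :* v :* c) :+ u :* c) refl a b c u v ⟩
    (a + (suc u + v) * b + u * v * c) + u * c
  ≤⟨ +-monoʳ-≤ (a + (suc u + v) * b + u * v * c) (*-monoˡ-≤ c u≤v) ⟩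
    (a + (suc u + v) * b + u * v * c) + v * c
  ≡⟨ solve 5 (λ a b c u v → (a :+ (con 1 :+ u :+ v) :* b :+ u :* v :* c) :+ v :* c
                         := a :+ v :* b :+ (con 1 :+ u) :* (b :+ v :* c)) refl a b c u v ⟩
    a + v * b + suc u * (b + v * c) ∎
  where
    open ≤-Reasoning
    a = esym xs (2 + s)
    b = esym xs (1 + s)
    c = esym xs s

-- Balanced partitions

div-mod-decomposition : ∀ r m → m ≡ m / suc r * suc r + m % suc r
div-mod-decomposition r m = trans (m≡m%n+[m/n]*n m (suc r)) (+-comm (m % suc r) _)

remainder≤ : ∀ r m → m % suc r ≤ r
remainder≤ r m = ≤-pred (m%n<n m (suc r))

div-mod-unique : ∀ r Q b → b < suc r → (Q * suc r + b) / suc r ≡ Q × (Q * suc r + b) % suc r ≡ b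
div-mod-unique r Q b b<r = quotient , remainder
  where
    open ≡-Reasoning
    reorder = +-comm (Q * suc r) b
    remainder : (Q * suc r + b) % suc r ≡ b
    remainder = begin
      (Q * suc r + b) % suc r ≡⟨ cong (_% suc r) reorder ⟩
      (b + Q * suc r) % suc r ≡⟨ [m+kn]%n≡m%n b Q (suc r) ⟩
      b % suc r               ≡⟨ m<n⇒m%n≡m b<r ⟩
      b                       ∎
    no-carry : b % suc r + Q * suc r % suc r < suc r
    no-carry = subst (_< suc r) (sym (trans (cong₂ _+_ (m<n⇒m%n≡m b<r) (m*n%n≡0 Q (suc r))) (+-identityʳ b))) b<r
    quotient : (Q * suc r + b) / suc r ≡ Q
    quotient = begin
      (Q * suc r + b) / suc r         ≡⟨ cong (_/ suc r) reorder ⟩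
      (b + Q * suc r) / suc r         ≡⟨ +-distrib-/ b (Q * suc r) no-carry ⟩
      b / suc r + Q * suc r / suc r   ≡⟨ cong₂ _+_ (m<n⇒m/n≡0 b<r) (m*n/n≡m Q (suc r)) ⟩
      Q                               ∎

div-mod-suc : ∀ r M → let Q = M / suc r; b = M % suc r in
  (suc M / suc r ≡ Q × suc M % suc r ≡ suc b) ⊎ (suc b ≡ suc r × suc M / suc r ≡ suc Q × suc M % suc r ≡ 0)
div-mod-suc r M = carry (m≤n⇒m<n∨m≡n (s≤s (remainder≤ r M)))
  where
    open ≡-Reasoning
    Q = M / suc r
    b = M % suc r
    suc-M : suc M ≡ Q * suc r + suc b
    suc-M = trans (cong suc (div-mod-decomposition r M)) (sym (+-suc (Q * suc r) b))
    carry : suc b < suc r ⊎ suc b ≡ suc r →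
      (suc M / suc r ≡ Q × suc M % suc r ≡ suc b) ⊎ (suc b ≡ suc r × suc M / suc r ≡ suc Q × suc M % suc r ≡ 0)
    carry (inj₁ b+1<r) =
      inj₁ (subst (λ m → m / suc r ≡ Q × m % suc r ≡ suc b) (sym suc-M) (div-mod-unique r Q (suc b) b+1<r))
    carry (inj₂ b+1≡r) =
      inj₂ (b+1≡r , subst (λ m → m / suc r ≡ suc Q × m % suc r ≡ 0) (sym suc-M′)
                          (div-mod-unique r (suc Q) 0 (s≤s z≤n)))
      where
        suc-M′ : suc M ≡ suc Q * suc r + 0
        suc-M′ = begin
          suc M                   ≡⟨ suc-M ⟩
          Q * suc r + suc b       ≡⟨ cong (Q * suc r +_) b+1≡r ⟩
          Q * suc r + suc r       ≡⟨ +-comm (Q * suc r) (suc r) ⟩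
          suc Q * suc r           ≡⟨ +-identityʳ (suc Q * suc r) ⟨
          suc Q * suc r + 0       ∎

≤-quotient : ∀ r {x M} → x * suc r ≤ M → x ≤ M / suc r
≤-quotient r {x} {M} xr≤M = subst (_≤ M / suc r) (m*n/n≡m x (suc r)) (/-monoˡ-≤ (suc r) xr≤M)

quotient-≤ : ∀ r {x M} → M < suc x * suc r → M / suc r ≤ x
quotient-≤ r M<xr = ≤-pred (m<n*o⇒m/o<n M<xr)

parts : ℕ → ℕ → ℕ → List ℕ
parts r Q b = replicate b (suc Q) ++ replicate (r ∸ b) Q

-- the part sizes of the Turán graph T_r(m)
balanced : ℕ → ℕ → List ℕ
balanced zero    m = []
balanced (suc r) m = parts (suc r) (m / suc r) (m % suc r)

balanced-exact : ∀ r Q b → b < suc r → balanced (suc r) (Q * suc r + b) ≡ parts (suc r) Q b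
balanced-exact r Q b b<r = cong₂ (parts (suc r)) (proj₁ unique) (proj₂ unique)
  where unique = div-mod-unique r Q b b<r

balanced-parts : ∀ r Q b → b ≤ suc r → balanced (suc r) (Q * suc r + b) ≡ parts (suc r) Q b
balanced-parts r Q b b≤r with m≤n⇒m<n∨m≡n b≤r
... | inj₁ b<r  = balanced-exact r Q b b<r
... | inj₂ refl = begin
    balanced (suc r) (Q * suc r + suc r)
  ≡⟨ cong (balanced (suc r)) (trans (+-comm (Q * suc r) (suc r)) (sym (+-identityʳ (suc Q * suc r)))) ⟩
    balanced (suc r) (suc Q * suc r + 0)
  ≡⟨ balanced-exact r (suc Q) 0 (s≤s z≤n) ⟩
    replicate (suc r) (suc Q)
  ≡⟨ sym (++-identityʳ _) ⟩
    replicate (suc r) (suc Q) ++ []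
  ≡⟨ cong (λ k → replicate (suc r) (suc Q) ++ replicate k Q) (sym (n∸n≡0 r)) ⟩
    parts (suc r) Q (suc r) ∎
  where open ≡-Reasoning

balanced-peel : ∀ r m → balanced (suc r) m ↭ m / suc r ∷ parts r (m / suc r) (m % suc r)
balanced-peel r m =
  subst (λ k → replicate b (suc Q) ++ replicate k Q ↭ Q ∷ parts r Q b)
        (sym (+-∸-assoc 1 (remainder≤ r m)))
        (shift Q (replicate b (suc Q)) (replicate (r ∸ b) Q))
  where
    Q = m / suc r
    b = m % suc r

balanced-suc : ∀ r m → balanced (suc r) (suc m) ≡ suc (m / suc r) ∷ parts r (m / suc r) (m % suc r)
balanced-suc r m = trans (cong (balanced (suc r)) suc-m) (balanced-parts r Q (suc b) (s≤s (remainder≤ r m)))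
  where
    Q = m / suc r
    b = m % suc r
    suc-m : suc m ≡ Q * suc r + suc b
    suc-m = trans (cong suc (div-mod-decomposition r m)) (sym (+-suc (Q * suc r) b))

module _ (r M s : ℕ) where
  private
    Q = M / suc r
    R = parts r Q (M % suc r)

    esym-balanced-suc : ∀ x → esym (x ∷ balanced (suc r) (suc M)) s ≡ esym (x ∷ suc Q ∷ R) s
    esym-balanced-suc x = cong (λ xs → esym (x ∷ xs) s) (balanced-suc r M)

    esym-balanced : ∀ x → esym (x ∷ balanced (suc r) M) s ≡ esym (x ∷ Q ∷ R) s
    esym-balanced x = esym-∷-cong x (esym-↭ (balanced-peel r M)) s

  esym-balanced-mono-suc : esym (balanced (suc r) M) s ≤ esym (balanced (suc r) (suc M)) s
  esym-balanced-mono-suc = begin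
    esym (balanced (suc r) M) s       ≡⟨ esym-↭ (balanced-peel r M) s ⟩
    esym (Q ∷ R) s                    ≤⟨ esym-monoˡ-≤ R (n≤1+n Q) s ⟩
    esym (suc Q ∷ R) s                ≡⟨ cong (λ xs → esym xs s) (balanced-suc r M) ⟨
    esym (balanced (suc r) (suc M)) s ∎
    where open ≤-Reasoning

  esym-balanced-up : ∀ x → x ≤ Q → esym (x ∷ balanced (suc r) (suc M)) s ≤ esym (suc x ∷ balanced (suc r) M) s
  esym-balanced-up x x≤Q = begin
    esym (x ∷ balanced (suc r) (suc M)) s ≡⟨ esym-balanced-suc x ⟩
    esym (x ∷ suc Q ∷ R) s                ≤⟨ esym-transfer R x≤Q s ⟩
    esym (suc x ∷ Q ∷ R) s                ≡⟨ esym-balanced (suc x) ⟨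
    esym (suc x ∷ balanced (suc r) M) s   ∎
    where open ≤-Reasoning

  esym-balanced-down : ∀ x → Q ≤ x → esym (suc x ∷ balanced (suc r) M) s ≤ esym (x ∷ balanced (suc r) (suc M)) s
  esym-balanced-down x Q≤x = begin
    esym (suc x ∷ balanced (suc r) M) s   ≡⟨ esym-balanced (suc x) ⟩
    esym (suc x ∷ Q ∷ R) s                ≡⟨ esym-swap (suc x) Q R s ⟩
    esym (Q ∷ suc x ∷ R) s                ≤⟨ esym-transfer R Q≤x s ⟩
    esym (suc Q ∷ x ∷ R) s                ≡⟨ esym-swap (suc Q) x R s ⟩
    esym (x ∷ suc Q ∷ R) s                ≡⟨ esym-balanced-suc x ⟨
    esym (x ∷ balanced (suc r) (suc M)) s ∎
    where open ≤-Reasoning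

esym-balanced-mono : ∀ r {M M′} → M ≤ M′ → ∀ s → esym (balanced r M) s ≤ esym (balanced r M′) s
esym-balanced-mono zero    _    s = ≤-refl
esym-balanced-mono (suc r) {M} M≤M′ s with m≤n⇒∃[o]m+o≡n M≤M′
... | o , refl = climb o
  where
    climb : ∀ o → esym (balanced (suc r) M) s ≤ esym (balanced (suc r) (M + o)) s
    climb zero    rewrite +-identityʳ M = ≤-refl
    climb (suc o) rewrite +-suc M o = ≤-trans (climb o) (esym-balanced-mono-suc r (M + o) s)

balanced-one : ∀ m → balanced 1 m ≡ m ∷ []
balanced-one m = cong₂ (parts 1) (n/1≡n m) (n%1≡0 m)

-- e_s(x ∷ balanced (r + 1) (m ∸ x)) is unimodal in x, with its peak at the smallest part
-- m / (r + 2) of balanced (r + 2) m; the peak is approached one unit at a time.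
module _ (r m s : ℕ) where
  private
    R = suc r
    Q = m / suc R
    b = m % suc R
    M = Q * R + b
    peak = esym (Q ∷ balanced R M) s

  m≡peak+rest : m ≡ Q + M
  m≡peak+rest = trans (div-mod-decomposition R m) (trans (cong (_+ b) (*-suc Q R)) (+-assoc Q (Q * R) b))

  balanced-peak : esym (balanced (suc R) m) s ≡ peak
  balanced-peak = trans (esym-↭ (balanced-peel R m) s)
    (esym-∷-cong Q (λ s → cong (λ xs → esym xs s) (sym (balanced-parts r Q b (remainder≤ R m)))) s)

  private
    at-peak : ∀ {x N} → x ≡ Q → x + N ≡ Q + M → esym (x ∷ balanced R N) s ≤ peak
    at-peak refl x+N≡ rewrite +-cancelˡ-≡ Q _ _ x+N≡ = ≤-refl

  esym-climb : ∀ k x N → x + k ≡ Q → x + N ≡ Q + M → esym (x ∷ balanced R N) s ≤ peak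
  esym-climb zero    x N x≡Q x+N≡ = at-peak (trans (sym (+-identityʳ x)) x≡Q) x+N≡
  esym-climb (suc k) x N x+k≡Q x+N≡ = subst (λ N → esym (x ∷ balanced R N) s ≤ peak) (sym N≡) (≤-trans
      (esym-balanced-up r (k + M) s x (≤-quotient r x≤N₀))
      (esym-climb k (suc x) (k + M) (trans (sym (+-suc x k)) x+k≡Q) (trans (sym (+-suc x (k + M))) x+N≡′)))
    where
      N≡ : N ≡ suc k + M
      N≡ = +-cancelˡ-≡ x N (suc k + M) (trans x+N≡ (trans (cong (_+ M) (sym x+k≡Q)) (+-assoc x (suc k) M)))
      x+N≡′ : x + suc (k + M) ≡ Q + M
      x+N≡′ = subst (λ N → x + N ≡ Q + M) N≡ x+N≡
      x≤N₀ : x * R ≤ k + M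
      x≤N₀ = ≤-trans (*-monoˡ-≤ R (subst (x ≤_) x+k≡Q (m≤m+n x (suc k))))
                     (≤-trans (m≤m+n (Q * R) b) (m≤n+m M k))

  esym-descend : ∀ k x N → x ≡ Q + k → x + N ≡ Q + M → esym (x ∷ balanced R N) s ≤ peak
  esym-descend zero    x N x≡Q x+N≡ = at-peak (trans x≡Q (+-identityʳ Q)) x+N≡
  esym-descend (suc k) x N x≡ x+N≡ = subst (λ x → esym (x ∷ balanced R N) s ≤ peak) (sym x≡′) (≤-trans
      (esym-balanced-down r N s (Q + k) (quotient-≤ r N<))
      (esym-descend k (Q + k) (suc N) refl (trans (+-suc (Q + k) N) x+N≡′)))
    where
      x≡′ : x ≡ suc (Q + k)
      x≡′ = trans x≡ (+-suc Q k)
      x+N≡′ : suc (Q + k) + N ≡ Q + M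
      x+N≡′ = subst (λ x → x + N ≡ Q + M) x≡′ x+N≡
      M≡ : M ≡ suc k + N
      M≡ = +-cancelˡ-≡ Q M (suc k + N)
             (trans (sym x+N≡′) (trans (cong (_+ N) (sym (+-suc Q k))) (+-assoc Q (suc k) N)))
      N< : N < suc (Q + k) * R
      N< = begin-strict
        N                 <⟨ s≤s (m≤n+m N k) ⟩
        suc k + N         ≡⟨ M≡ ⟨
        Q * R + b         ≤⟨ +-monoʳ-≤ (Q * R) (remainder≤ R m) ⟩
        Q * R + R         ≡⟨ +-comm (Q * R) R ⟩
        suc Q * R         ≤⟨ *-monoˡ-≤ R (s≤s (m≤m+n Q k)) ⟩
        suc (Q + k) * R   ∎
        where open ≤-Reasoning

  esym-≤-peak : ∀ x N → x + N ≡ m → esym (x ∷ balanced R N) s ≤ peak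
  esym-≤-peak x N x+N≡m with ≤-total x Q
  ... | inj₁ x≤Q = esym-climb (Q ∸ x) x N (m+[n∸m]≡n x≤Q) (trans x+N≡m m≡peak+rest)
  ... | inj₂ Q≤x = esym-descend (x ∸ Q) x N (sym (m+[n∸m]≡n Q≤x)) (trans x+N≡m m≡peak+rest)

esym-head-balanced : ∀ r {m d} → d ≤ m → ∀ s → esym ((m ∸ d) ∷ balanced r d) s ≤ esym (balanced (suc r) m) s
esym-head-balanced zero    {m} {d} d≤m s rewrite balanced-one m = esym-monoˡ-≤ [] (m∸n≤m m d) s
esym-head-balanced (suc r) {m} {d} d≤m s =
  subst (esym ((m ∸ d) ∷ balanced (suc r) d) s ≤_) (sym (balanced-peak r m s))
        (esym-≤-peak r m s (m ∸ d) d (m∸n+n≡m d≤m))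

-- Zykov's theorem

neighbourhood-clique-free : (G : Graph n) (U : VSet n) {r : ℕ} → cliques G U (suc r) ≡ 0 →
                            ∀ v → U v ≡ true → cliques G (U ∩ adj G v) r ≡ 0
neighbourhood-clique-free G U {r} free v v∈U = m+n≡0⇒n≡0 (cliques G (U - v) (suc r)) (begin
    cliques G (U - v) (suc r) + cliques G (U ∩ adj G v) r
  ≡⟨ cong (λ b → cliques G (U - v) (suc r) + b ⊙ cliques G (U ∩ adj G v) r) v∈U ⟨
    cliques G (U - v) (suc r) + U v ⊙ cliques G (U ∩ adj G v) r
  ≡⟨ cliques-remove G U v r ⟨
    cliques G U (suc r)
  ≡⟨ free ⟩
    0 ∎)
  where open ≡-Reasoning

cliques≤esym-balanced : ∀ r (G : Graph n) (U : VSet n) → cliques G U (suc r) ≡ 0 →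
                        ∀ s → cliques G U s ≤ esym (balanced r (count U)) s
cliques≤esym-balanced r       G U free zero = ≤-refl
cliques≤esym-balanced zero    G U free (suc s) =
  ≤-trans (≤-reflexive (cliques-empty G (count≡0⇒empty U (trans (sym (cliques-one G U)) free)) s)) z≤n
cliques≤esym-balanced (suc r) G U free (suc s) with empty-or-member U
... | inj₁ empty  = ≤-trans (≤-reflexive (cliques-empty G empty s)) z≤n
... | inj₂ member = begin
    cliques G U (suc s)
  ≤⟨ cliques-peel G A U (λ i → ∧-conicalˡ (U i) _) bound ⟩
    cliques G A (suc s) + out * X
  ≤⟨ +-monoˡ-≤ (out * X) (cliques≤esym-balanced r G A (neighbourhood-clique-free G U free x x∈U) (suc s)) ⟩
    esym (out ∷ balanced r d) (suc s)
  ≡⟨ cong (λ o → esym (o ∷ balanced r d) (suc s)) (sym (trans (cong (_∸ d) |U|≡d+out) (m+n∸m≡n d out))) ⟩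
    esym ((count U ∸ d) ∷ balanced r d) (suc s)
  ≤⟨ esym-head-balanced r (subst (d ≤_) (sym |U|≡d+out) (m≤m+n d out)) (suc s) ⟩
    esym (balanced (suc r) (count U)) (suc s) ∎
  where
    open ≤-Reasoning
    max = maximiser U (λ v → count (U ∩ adj G v)) member
    x = proj₁ max
    x∈U = proj₁ (proj₂ max)
    A = U ∩ adj G x
    d = count A
    out = count (U ∖ A)
    X = esym (balanced r d) s
    |U|≡d+out : count U ≡ d + out
    |U|≡d+out = trans (count-∩-∖ U A) (cong (_+ out) (count-cong (λ i → ∧-absorbˡ (U i) _)))
      where ∧-absorbˡ : ∀ a b → a ∧ (a ∧ b) ≡ a ∧ b
            ∧-absorbˡ true  b = refl
            ∧-absorbˡ false b = refl
    bound : ∀ v → U v ≡ true → cliques G (U ∩ adj G v) s ≤ X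
    bound v v∈U = ≤-trans (cliques≤esym-balanced r G (U ∩ adj G v) (neighbourhood-clique-free G U free v v∈U) s)
                          (esym-balanced-mono r (proj₂ (proj₂ max) v v∈U) s)

-- Complete multipartite graphs

applyUpTo-cong : ∀ r {f g : ℕ → ℕ} → (∀ j → j < r → f j ≡ g j) → applyUpTo f r ≡ applyUpTo g r
applyUpTo-cong zero    eq = refl
applyUpTo-cong (suc r) eq = cong₂ _∷_ (eq 0 (s≤s z≤n)) (applyUpTo-cong r (λ j j<r → eq (suc j) (s≤s j<r)))

esym-zeroˡ : ∀ xs s → esym (0 ∷ xs) s ≡ esym xs s
esym-zeroˡ xs zero    = refl
esym-zeroˡ xs (suc s) = +-identityʳ _

clear : ℕ → (ℕ → ℕ) → ℕ → ℕ
clear p f j = if p ≡ᵇ j then 0 else f j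

-- A new vertex in class p lies in exactly those new s + 1 cliques that use no other vertex of class p.
esym-add-vertex : ∀ r p (f : ℕ → ℕ) s → p < r →
  esym (applyUpTo (λ j → 𝟙 (p ≡ᵇ j) + f j) r) (suc s)
    ≡ esym (applyUpTo f r) (suc s) + esym (applyUpTo (clear p f) r) s
esym-add-vertex (suc r) zero f s _ = begin
    e (suc s) + suc (f 0) * e s
  ≡⟨ solve 3 (λ a x b → a :+ (con 1 :+ x) :* b := a :+ x :* b :+ b) refl (e (suc s)) (f 0) (e s) ⟩
    e (suc s) + f 0 * e s + e s
  ≡⟨ cong (e (suc s) + f 0 * e s +_) (esym-zeroˡ (applyUpTo (f ∘ suc) r) s) ⟨
    e (suc s) + f 0 * e s + esym (0 ∷ applyUpTo (f ∘ suc) r) s ∎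
  where
    open ≡-Reasoning
    e = esym (applyUpTo (f ∘ suc) r)
esym-add-vertex (suc r) (suc p) f zero (s≤s p<r) = begin
    esym L 1 + f 0 * 1
  ≡⟨ cong (_+ f 0 * 1) (esym-add-vertex r p (f ∘ suc) zero p<r) ⟩
    esym (applyUpTo (f ∘ suc) r) 1 + 1 + f 0 * 1
  ≡⟨ +-swapʳ (esym (applyUpTo (f ∘ suc) r) 1) 1 (f 0 * 1) ⟩
    esym (applyUpTo (f ∘ suc) r) 1 + f 0 * 1 + 1 ∎
  where
    open ≡-Reasoning
    L = applyUpTo (λ j → 𝟙 (p ≡ᵇ j) + f (suc j)) r
esym-add-vertex (suc r) (suc p) f (suc s) (s≤s p<r) = begin
    esym L (2 + s) + f 0 * esym L (1 + s)
  ≡⟨ cong₂ (λ x y → x + f 0 * y) (esym-add-vertex r p (f ∘ suc) (suc s) p<r)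
                                  (esym-add-vertex r p (f ∘ suc) s p<r) ⟩
    (a (2 + s) + c (1 + s)) + f 0 * (a (1 + s) + c s)
  ≡⟨ cong ((a (2 + s) + c (1 + s)) +_) (*-distribˡ-+ (f 0) (a (1 + s)) (c s)) ⟩
    (a (2 + s) + c (1 + s)) + (f 0 * a (1 + s) + f 0 * c s)
  ≡⟨ +-interchange (a (2 + s)) (c (1 + s)) _ _ ⟩
    (a (2 + s) + f 0 * a (1 + s)) + (c (1 + s) + f 0 * c s) ∎
  where
    open ≡-Reasoning
    L = applyUpTo (λ j → 𝟙 (p ≡ᵇ j) + f (suc j)) r
    a = esym (applyUpTo (f ∘ suc) r)
    c = esym (applyUpTo (clear p (f ∘ suc)) r)

esym-zeros : ∀ r s → esym (applyUpTo (λ _ → 0) r) (suc s) ≡ 0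
esym-zeros zero    s = refl
esym-zeros (suc r) s = trans (+-identityʳ _) (esym-zeros r s)

esym-add-vertex-if : ∀ b r p (f : ℕ → ℕ) s → p < r →
  esym (applyUpTo f r) (suc s) + b ⊙ esym (applyUpTo (clear p f) r) s
    ≡ esym (applyUpTo (λ j → 𝟙 (b ∧ (p ≡ᵇ j)) + f j) r) (suc s)
esym-add-vertex-if false r p f s _   = +-identityʳ _
esym-add-vertex-if true  r p f s p<r = sym (esym-add-vertex r p f s p<r)

classSize : (Fin n → ℕ) → VSet n → ℕ → ℕ
classSize c U j = count (λ i → U i ∧ (c i ≡ᵇ j))

≡ᵇ-congʳ : ∀ p {x y} → (x ≡ᵇ y) ≡ true → (p ≡ᵇ x) ≡ (p ≡ᵇ y)
≡ᵇ-congʳ p x≡y = cong (p ≡ᵇ_) (≡ᵇ-true⇒≡ x≡y)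

classSize-avoiding : ∀ p (c : Fin n → ℕ) (U : VSet n) j →
  classSize c (λ i → U i ∧ not (p ≡ᵇ c i)) j ≡ clear p (classSize c U) j
classSize-avoiding p c U j with p ≡ᵇ j in p≡j
... | true  = count-empty none
  where
    none : ∀ i → (U i ∧ not (p ≡ᵇ c i)) ∧ (c i ≡ᵇ j) ≡ false
    none i with c i ≡ᵇ j in cᵢ≡j
    ... | false = ∧-zeroʳ _
    ... | true = trans (cong (λ b → (U i ∧ not b) ∧ true) (trans (≡ᵇ-congʳ p cᵢ≡j) p≡j))
                       (cong (_∧ true) (∧-zeroʳ (U i)))
... | false = count-cong same
  where
    same : ∀ i → (U i ∧ not (p ≡ᵇ c i)) ∧ (c i ≡ᵇ j) ≡ U i ∧ (c i ≡ᵇ j)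
    same i with c i ≡ᵇ j in cᵢ≡j
    ... | false = trans (∧-zeroʳ _) (sym (∧-zeroʳ (U i)))
    ... | true = trans (cong (λ b → (U i ∧ not b) ∧ true) (trans (≡ᵇ-congʳ p cᵢ≡j) p≡j))
                       (cong (_∧ true) (∧-identityʳ (U i)))

cliques-multipartite : ∀ r (G : Graph n) (c : Fin n → ℕ) → (∀ i → c i < r) →
  (∀ i j → adj G i j ≡ not (c i ≡ᵇ c j)) →
  ∀ U s → cliques G U s ≡ esym (applyUpTo (classSize c U) r) s
cliques-multipartite         r G c c<r col U zero    = refl
cliques-multipartite {zero}  r G c c<r col U (suc s) = sym (esym-zeros r s)
cliques-multipartite {suc n} r G c c<r col U (suc s) = begin
    cliques H (U ∘ suc) (suc s) + U zero ⊙ cliques H ((U ∩ adj G zero) ∘ suc) s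
  ≡⟨ cong₂ (λ x y → x + U zero ⊙ y) (IH (U ∘ suc) (suc s)) (IH ((U ∩ adj G zero) ∘ suc) s) ⟩
    esym (applyUpTo (classSize c′ (U ∘ suc)) r) (suc s)
      + U zero ⊙ esym (applyUpTo (classSize c′ ((U ∩ adj G zero) ∘ suc)) r) s
  ≡⟨ cong (λ xs → esym (applyUpTo (classSize c′ (U ∘ suc)) r) (suc s) + U zero ⊙ esym xs s)
          (applyUpTo-cong r (λ j _ → trans (count-cong (λ i → cong (λ b → (U (suc i) ∧ b) ∧ (c′ i ≡ᵇ j))
                                                                   (col zero (suc i))))
                                           (classSize-avoiding (c zero) c′ (U ∘ suc) j))) ⟩
    esym (applyUpTo (classSize c′ (U ∘ suc)) r) (suc s)
      + U zero ⊙ esym (applyUpTo (clear (c zero) (classSize c′ (U ∘ suc))) r) s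
  ≡⟨ esym-add-vertex-if (U zero) r (c zero) (classSize c′ (U ∘ suc)) s (c<r zero) ⟩
    esym (applyUpTo (classSize c U) r) (suc s) ∎
  where
    open ≡-Reasoning
    H = tail G
    c′ = c ∘ suc
    IH = cliques-multipartite r H c′ (c<r ∘ suc) (λ i j → col (suc i) (suc j))

count-last : (U : VSet (suc n)) → count U ≡ count (U ∘ inject₁) + 𝟙 (U (fromℕ n))
count-last {zero}  U = +-identityʳ (𝟙 (U zero))
count-last {suc n} U = trans (cong (𝟙 (U zero) +_) (count-last (U ∘ suc))) (sym (+-assoc (𝟙 (U zero)) _ _))

𝟙-<ᵇ-suc : ∀ j b → 𝟙 (j <ᵇ b) + 𝟙 (b ≡ᵇ j) ≡ 𝟙 (j <ᵇ suc b)
𝟙-<ᵇ-suc zero    zero    = refl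
𝟙-<ᵇ-suc zero    (suc b) = refl
𝟙-<ᵇ-suc (suc j) zero    = refl
𝟙-<ᵇ-suc (suc j) (suc b) = 𝟙-<ᵇ-suc j b

<ᵇ-zero : ∀ j → (j <ᵇ 0) ≡ false
<ᵇ-zero zero    = refl
<ᵇ-zero (suc j) = refl

<ᵇ⇒true : ∀ {j b} → j < b → (j <ᵇ b) ≡ true
<ᵇ⇒true {j} {b} j<b = Equivalence.to T-≡ (<⇒<ᵇ j<b)

residue-class-size : ∀ r M j → j < suc r →
  count (λ (i : Fin M) → toℕ i % suc r ≡ᵇ j) ≡ M / suc r + 𝟙 (j <ᵇ M % suc r)
residue-class-size r zero    j j<r = refl
residue-class-size r (suc M) j j<r = begin
    count (λ (i : Fin (suc M)) → toℕ i % suc r ≡ᵇ j)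
  ≡⟨ count-last (λ (i : Fin (suc M)) → toℕ i % suc r ≡ᵇ j) ⟩
    count (λ (i : Fin M) → toℕ (inject₁ i) % suc r ≡ᵇ j) + 𝟙 (toℕ (fromℕ M) % suc r ≡ᵇ j)
  ≡⟨ cong₂ (λ x y → x + 𝟙 (y % suc r ≡ᵇ j))
       (trans (count-cong (λ (i : Fin M) → cong (λ x → x % suc r ≡ᵇ j) (toℕ-inject₁ i)))
              (residue-class-size r M j j<r))
       (toℕ-fromℕ M) ⟩
    Q + 𝟙 (j <ᵇ b) + 𝟙 (b ≡ᵇ j)
  ≡⟨ trans (+-assoc Q _ _) (cong (Q +_) (𝟙-<ᵇ-suc j b)) ⟩
    Q + 𝟙 (j <ᵇ suc b)
  ≡⟨ carry (div-mod-suc r M) ⟩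
    suc M / suc r + 𝟙 (j <ᵇ suc M % suc r) ∎
  where
    open ≡-Reasoning
    Q = M / suc r
    b = M % suc r
    carry : (suc M / suc r ≡ Q × suc M % suc r ≡ suc b)
          ⊎ (suc b ≡ suc r × suc M / suc r ≡ suc Q × suc M % suc r ≡ 0) →
            Q + 𝟙 (j <ᵇ suc b) ≡ suc M / suc r + 𝟙 (j <ᵇ suc M % suc r)
    carry (inj₁ (quotient , remainder)) = sym (cong₂ (λ q c → q + 𝟙 (j <ᵇ c)) quotient remainder)
    carry (inj₂ (b+1≡r , quotient , remainder)) = begin
      Q + 𝟙 (j <ᵇ suc b)                     ≡⟨ cong (λ c → Q + 𝟙 (j <ᵇ c)) b+1≡r ⟩
      Q + 𝟙 (j <ᵇ suc r)                     ≡⟨ cong (λ c → Q + 𝟙 c) (<ᵇ⇒true j<r) ⟩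
      Q + 1                                  ≡⟨ +-comm Q 1 ⟩
      suc Q                                  ≡⟨ +-identityʳ (suc Q) ⟨
      suc Q + 𝟙 false                        ≡⟨ cong (λ c → suc Q + 𝟙 c) (<ᵇ-zero j) ⟨
      suc Q + 𝟙 (j <ᵇ 0)                     ≡⟨ cong₂ (λ q c → q + 𝟙 (j <ᵇ c)) quotient remainder ⟨
      suc M / suc r + 𝟙 (j <ᵇ suc M % suc r) ∎

applyUpTo-parts : ∀ r Q b → b ≤ r → applyUpTo (λ j → Q + 𝟙 (j <ᵇ b)) r ≡ parts r Q b
applyUpTo-parts zero    Q zero    _         = refl
applyUpTo-parts (suc r) Q zero    _         = cong₂ _∷_ (+-identityʳ Q) (applyUpTo-parts r Q zero z≤n)
applyUpTo-parts (suc r) Q (suc b) (s≤s b≤r) = cong₂ _∷_ (+-comm Q 1) (applyUpTo-parts r Q b b≤r)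

cliques-turan : ∀ w Δ s → cliques (turan (suc w) Δ) (λ _ → true) s ≡ esym (balanced (suc w) Δ) s
cliques-turan w Δ s = begin
    cliques (turan (suc w) Δ) (λ _ → true) s
  ≡⟨ cliques-multipartite (suc w) (turan (suc w) Δ) colour (λ i → m%n<n (toℕ i) (suc w)) (λ i j → refl) _ s ⟩
    esym (applyUpTo (λ j → count (λ i → colour i ≡ᵇ j)) (suc w)) s
  ≡⟨ cong (λ xs → esym xs s) (applyUpTo-cong (suc w) (residue-class-size w Δ)) ⟩
    esym (applyUpTo (λ j → Δ / suc w + 𝟙 (j <ᵇ Δ % suc w)) (suc w)) s
  ≡⟨ cong (λ xs → esym xs s) (applyUpTo-parts (suc w) (Δ / suc w) (Δ % suc w) (m%n≤n Δ (suc w))) ⟩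
    esym (balanced (suc w) Δ) s ∎
  where
    open ≡-Reasoning
    colour : Fin Δ → ℕ
    colour i = toℕ i % suc w

sumUpTo : ℕ → (ℕ → ℕ) → ℕ
sumUpTo n f = sum (applyUpTo f n)

sumUpTo-cong : ∀ n {f g : ℕ → ℕ} → (∀ i → i < n → f i ≡ g i) → sumUpTo n f ≡ sumUpTo n g
sumUpTo-cong n eq = cong sum (applyUpTo-cong n eq)

sumUpTo-+ : ∀ n (f g : ℕ → ℕ) → sumUpTo n (λ i → f i + g i) ≡ sumUpTo n f + sumUpTo n g
sumUpTo-+ zero    f g = refl
sumUpTo-+ (suc n) f g =
  trans (cong (f 0 + g 0 +_) (sumUpTo-+ n (f ∘ suc) (g ∘ suc))) (+-interchange (f 0) (g 0) _ _)

sumUpTo-* : ∀ n x (f : ℕ → ℕ) → sumUpTo n (λ i → x * f i) ≡ x * sumUpTo n f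
sumUpTo-* zero    x f = sym (*-zeroʳ x)
sumUpTo-* (suc n) x f =
  trans (cong (x * f 0 +_) (sumUpTo-* n x (f ∘ suc))) (sym (*-distribˡ-+ x (f 0) _))

sumUpTo-extend : ∀ {n} N (f : ℕ → ℕ) → n ≤ N → (∀ i → n ≤ i → f i ≡ 0) → sumUpTo N f ≡ sumUpTo n f
sumUpTo-extend {zero}  zero    f _         _      = refl
sumUpTo-extend {zero}  (suc N) f _         vanish =
  cong₂ _+_ (vanish 0 z≤n) (sumUpTo-extend N (f ∘ suc) z≤n (λ i _ → vanish (suc i) z≤n))
sumUpTo-extend {suc n} (suc N) f (s≤s n≤N) vanish =
  cong (f 0 +_) (sumUpTo-extend N (f ∘ suc) n≤N (λ i n≤i → vanish (suc i) (s≤s n≤i)))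

esym-replicate : ∀ c y j → esym (replicate c y) j ≡ (c C j) * y ^ j
esym-replicate c       y zero    = refl
esym-replicate zero    y (suc j) = refl
esym-replicate (suc c) y (suc j) = begin
    esym (replicate c y) (suc j) + y * esym (replicate c y) j
  ≡⟨ cong₂ (λ u v → u + y * v) (esym-replicate c y (suc j)) (esym-replicate c y j) ⟩
    (c C suc j) * (y * y ^ j) + y * ((c C j) * y ^ j)
  ≡⟨ solve 4 (λ a b y p → a :* (y :* p) :+ y :* (b :* p) := (b :+ a) :* (y :* p)) refl (c C suc j) (c C j) y (y ^ j) ⟩
    ((c C j) + (c C suc j)) * (y * y ^ j)
  ≡⟨ cong (_* (y * y ^ j)) (nCk+nC[k+1]≡[n+1]C[k+1] c j) ⟩
    (suc c C suc j) * (y * y ^ j) ∎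
  where open ≡-Reasoning

esym-replicate-++ : ∀ b x xs s →
  esym (replicate b x ++ xs) s ≡ sumUpTo (suc s) (λ i → (b C i) * x ^ i * esym xs (s ∸ i))
esym-replicate-++ zero    x xs s =
  sym (trans (cong₂ _+_ (*-identityˡ (esym xs s))
                        (sumUpTo-extend s (λ i → 0 * x ^ suc i * esym xs (s ∸ suc i)) z≤n (λ _ _ → refl)))
             (+-identityʳ _))
esym-replicate-++ (suc b) x xs zero    = refl
esym-replicate-++ (suc b) x xs (suc s) = begin
    esym L (suc s) + x * esym L s
  ≡⟨ cong₂ (λ u v → u + x * v) (esym-replicate-++ b x xs (suc s)) (esym-replicate-++ b x xs s) ⟩
    (esym xs (suc s) + 0 + sumUpTo (suc s) without) + x * sumUpTo (suc s) with′
  ≡⟨ cong (λ z → z + sumUpTo (suc s) without + x * sumUpTo (suc s) with′) (+-identityʳ (esym xs (suc s))) ⟩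
    esym xs (suc s) + sumUpTo (suc s) without + x * sumUpTo (suc s) with′
  ≡⟨ trans (+-assoc (esym xs (suc s)) _ _) (cong (esym xs (suc s) +_) (+-comm (sumUpTo (suc s) without) _)) ⟩
    esym xs (suc s) + (x * sumUpTo (suc s) with′ + sumUpTo (suc s) without)
  ≡⟨ cong (λ z → esym xs (suc s) + (z + sumUpTo (suc s) without)) (sumUpTo-* (suc s) x with′) ⟨
    esym xs (suc s) + (sumUpTo (suc s) (λ i → x * with′ i) + sumUpTo (suc s) without)
  ≡⟨ cong (esym xs (suc s) +_) (sumUpTo-+ (suc s) (λ i → x * with′ i) without) ⟨
    esym xs (suc s) + sumUpTo (suc s) (λ i → x * with′ i + without i)
  ≡⟨ cong₂ _+_ (sym (+-identityʳ (esym xs (suc s)))) (sumUpTo-cong (suc s) (λ i _ → pascal i)) ⟩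
    esym xs (suc s) + 0 + sumUpTo (suc s) (λ i → (suc b C suc i) * x ^ suc i * esym xs (s ∸ i)) ∎
  where
    open ≡-Reasoning
    L = replicate b x ++ xs
    with′ without : ℕ → ℕ
    with′   i = (b C i) * x ^ i * esym xs (s ∸ i)
    without i = (b C suc i) * x ^ suc i * esym xs (s ∸ i)
    pascal : ∀ i → x * with′ i + without i ≡ (suc b C suc i) * x ^ suc i * esym xs (s ∸ i)
    pascal i = trans
      (solve 5 (λ x a b p e → x :* (a :* p :* e) :+ b :* (x :* p) :* e := (a :+ b) :* (x :* p) :* e) refl
               x (b C i) (b C suc i) (x ^ i) (esym xs (s ∸ i)))
      (cong (λ z → z * x ^ suc i * esym xs (s ∸ i)) (nCk+nC[k+1]≡[n+1]C[k+1] b i))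

if-≤ᵇ-true : ∀ {i s} (x : ℕ) → i ≤ s → (if i ≤ᵇ s then x else 0) ≡ x
if-≤ᵇ-true x i≤s = cong (λ c → if c then x else 0) (Equivalence.to T-≡ (≤⇒≤ᵇ i≤s))

if-≤ᵇ-false : ∀ {i s} (x : ℕ) → s < i → (if i ≤ᵇ s then x else 0) ≡ 0
if-≤ᵇ-false {i} {s} x s<i with i ≤ᵇ s in i≤ᵇs
... | false = refl
... | true  = ⊥-elim (<⇒≱ s<i (≤ᵇ⇒≤ i s (Equivalence.from T-≡ i≤ᵇs)))

sumUpTo-guard : ∀ s b (g : ℕ → ℕ) → (∀ i → b < i → g i ≡ 0) →
  sumUpTo (suc s) g ≡ sumUpTo (suc b) (λ i → if i ≤ᵇ s then g i else 0)
sumUpTo-guard s b g beyond-b with ≤-total s b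
... | inj₁ s≤b = sym (trans
        (sumUpTo-extend (suc b) (λ i → if i ≤ᵇ s then g i else 0) (s≤s s≤b) (λ i s<i → if-≤ᵇ-false (g i) s<i))
        (sumUpTo-cong (suc s) (λ i i<s → if-≤ᵇ-true (g i) (≤-pred i<s))))
... | inj₂ b≤s = trans
        (sumUpTo-extend (suc s) g (s≤s b≤s) beyond-b)
        (sumUpTo-cong (suc b) (λ i i<b → sym (if-≤ᵇ-true (g i) (≤-trans (≤-pred i<b) b≤s))))

esym-parts : ∀ r a b s → esym (parts r a b) s
  ≡ sumUpTo (suc b) (λ i → if i ≤ᵇ s then (b C i) * ((r ∸ b) C (s ∸ i)) * (suc a ^ i) * (a ^ (s ∸ i)) else 0)
esym-parts r a b s = begin
    esym (replicate b (suc a) ++ replicate (r ∸ b) a) s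
  ≡⟨ esym-replicate-++ b (suc a) (replicate (r ∸ b) a) s ⟩
    sumUpTo (suc s) (λ i → (b C i) * suc a ^ i * esym (replicate (r ∸ b) a) (s ∸ i))
  ≡⟨ sumUpTo-cong (suc s) (λ i _ → trans (cong ((b C i) * suc a ^ i *_) (esym-replicate (r ∸ b) a (s ∸ i)))
                                         (reorder (b C i) ((r ∸ b) C (s ∸ i)) (suc a ^ i) (a ^ (s ∸ i)))) ⟩
    sumUpTo (suc s) term
  ≡⟨ sumUpTo-guard s b term
       (λ i b<i → cong (λ c → c * ((r ∸ b) C (s ∸ i)) * (suc a ^ i) * (a ^ (s ∸ i))) (k>n⇒nCk≡0 b<i)) ⟩
    sumUpTo (suc b) (λ i → if i ≤ᵇ s then term i else 0) ∎
  where
    open ≡-Reasoning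
    term : ℕ → ℕ
    term i = (b C i) * ((r ∸ b) C (s ∸ i)) * (suc a ^ i) * (a ^ (s ∸ i))
    reorder : ∀ p q u v → p * u * (q * v) ≡ p * q * u * v
    reorder = solve 4 (λ p q u v → p :* u :* (q :* v) := p :* q :* u :* v) refl

clique-density-bound : ∀ s r Δ (G : Graph n) → InClass Δ (suc (suc r)) G →
                       suc s * k (suc s) G ≤ n * k s (turan (suc r) Δ)
clique-density-bound {n} s r Δ G (degree≤Δ , clique≤ω) = begin
    suc s * k (suc s) G
  ≡⟨ cong (suc s *_) (k≡cliques (suc s) G) ⟩
    suc s * cliques G V (suc s)
  ≡⟨ cliques-double-count G V s ⟩
    ∑[ v < n ] (true ⊙ cliques G (adj G v) s)
  ≤⟨ ∑-mono-≤ _ _ link-bound ⟩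
    ∑[ v < n ] esym (balanced (suc r) Δ) s
  ≡⟨ ∑-const {n} (esym (balanced (suc r) Δ) s) ⟩
    n * esym (balanced (suc r) Δ) s
  ≡⟨ cong (n *_) (trans (k≡cliques s (turan (suc r) Δ)) (cliques-turan r Δ s)) ⟨
    n * k s (turan (suc r) Δ) ∎
  where
    open ≤-Reasoning
    V : VSet n
    V _ = true
    free : cliques G V (3 + r) ≡ 0
    free = trans (sym (k≡cliques (3 + r) G)) (no-larger-cliques (2 + r) G clique≤ω)
    link-bound : ∀ v → cliques G (adj G v) s ≤ esym (balanced (suc r) Δ) s
    link-bound v = ≤-trans (cliques≤esym-balanced (suc r) G (adj G v) (neighbourhood-clique-free G V free v refl) s)
                           (esym-balanced-mono (suc r) (subst (_≤ Δ) (countFin≡count (adj G v)) (degree≤Δ v)) s)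

k-turan≡turanSum : ∀ r s a b → b < suc r → k s (turan (suc r) (a * suc r + b)) ≡ turanSum (suc s) (2 + r) a b
k-turan≡turanSum r s a b b<r = begin
    k s (turan (suc r) (a * suc r + b))
  ≡⟨ k≡cliques s (turan (suc r) (a * suc r + b)) ⟩
    cliques (turan (suc r) (a * suc r + b)) (λ _ → true) s
  ≡⟨ cliques-turan r (a * suc r + b) s ⟩
    esym (balanced (suc r) (a * suc r + b)) s
  ≡⟨ cong (λ xs → esym xs s) (balanced-exact r a b b<r) ⟩
    esym (parts (suc r) a b) s
  ≡⟨ esym-parts (suc r) a b s ⟩
    sumUpTo (suc b) term
  ≡⟨ cong sum (map-upTo term (suc b)) ⟨
    turanSum (suc s) (2 + r) a b ∎
  where
    open ≡-Reasoning
    term : ℕ → ℕ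
    term i = if i ≤ᵇ s then (b C i) * ((suc r ∸ b) C (s ∸ i)) * (suc a ^ i) * (a ^ (s ∸ i)) else 0

lemma3p4 : (t Δ ω : ℕ) → 2 ≤ t → 2 ≤ Δ → 2 ≤ ω →
    (a b : ℕ) → Δ ≡ a * (ω ∸ 1) + b → b < ω ∸ 1 →
    ((n : ℕ) (G : Graph n) → InClass Δ ω G →
        t * k t G ≤ n * k (t ∸ 1) (turan (ω ∸ 1) Δ))
    × (k (t ∸ 1) (turan (ω ∸ 1) Δ) ≡ turanSum t ω a b)
lemma3p4 (suc (suc s)) Δ (suc (suc r)) (s≤s (s≤s _)) _ (s≤s (s≤s _)) a b refl b<r =
  (λ n → clique-density-bound (suc s) r Δ) , k-turan≡turanSum r (suc s) a b b<r
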